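{- Let $E$ be a finite set and let $\operatorname{Shade}:\mathcal{P}(E)\to\mathcal{P}(E)$ be a shade map on $E$. Define $\alpha(F)=F\cap\operatorname{Shade}F$ and $\tau(F)=F\cup(E\setminus\operatorname{Shade}F)$ for $F\in\mathcal{P}(E)$, and let $\mathbf{P}=\{[\alpha(F),\tau(F)]\mid F\in\mathcal{P}(E)\}$. Then: (a) $F\in[\alpha(F),\tau(F)]$ for every $F\in\mathcal{P}(E)$; (b) if $F\in\mathcal{P}(E)$ and $G\in[\alpha(F),\tau(F)]$, then $[\alpha(F),\tau(F)]=[\alpha(G),\tau(G)]$; (c) $\mathbf{P}$ is a Boolean interval partition of $\mathcal{P}(E)$; (d) $\operatorname{Shade}F=E\setminus(\tau(F)\setminus\alpha(F))$ for every $F\in\mathcal{P}(E)$.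
   Context: $\mathcal{P}(E)$ is the power set of $E$. For $U\subseteq V\subseteq E$, $[U,V]=\{I\in\mathcal{P}(E)\mid U\subseteq I\subseteq V\}$; a Boolean interval of $\mathcal{P}(E)$ is a set of this form. A Boolean interval partition of $\mathcal{P}(E)$ is a set of pairwise disjoint Boolean intervals of $\mathcal{P}(E)$ whose union is $\mathcal{P}(E)$. A shade map on $E$ is a map $S:\mathcal{P}(E)\to\mathcal{P}(E)$ such that for every $F\subseteq E$ and every $u\in E\setminus S(F)$ we have $S(F\cup\{u\})=S(F)$ and $S(F\setminus\{u\})=S(F)$. -}

module Defs where

open import Data.Nat using (ℕ)
open import Data.Fin using (Fin)
open import Data.Fin.Subset using (Subset; _∈_; _∉_; _⊆_; _∪_; _∩_; _─_; ∁; ⁅_⁆)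
open import Data.Product using (_×_; ∃; ∃-syntax)
open import Relation.Binary.PropositionalEquality using (_≡_)
open import Relation.Nullary using (¬_)
open import Level using (0ℓ)
import Relation.Unary as U

SetFamily : ℕ → Set₁
SetFamily n = U.Pred (Subset n) 0ℓ

[_,_] : ∀ {n} → Subset n → Subset n → SetFamily n
[ A , B ] I = (A ⊆ I) × (I ⊆ B)

IsBooleanInterval : ∀ {n} → SetFamily n → Set
IsBooleanInterval {n} P = ∃[ A ] ∃[ B ] (P U.≐ [ A , B ])

-- A collection of subsets of P(E), presented as an indexed family P : J → SetFamily n
-- (the collection being { P j | j : J }), is a Boolean interval partition of P(E) if
-- every member is a Boolean interval, distinct members are disjoint, and their union is P(E).
IsBooleanIntervalPartition : ∀ {n} {J : Set} → (J → SetFamily n) → Set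
IsBooleanIntervalPartition {n} {J} P =
  (∀ j → IsBooleanInterval (P j)) ×
  (∀ j k → ¬ (P j U.≐ P k) → ∀ I → ¬ (P j I × P k I)) ×
  (∀ (I : Subset n) → ∃[ j ] P j I)

IsShadeMap : ∀ {n} → (Subset n → Subset n) → Set
IsShadeMap {n} S = ∀ (F : Subset n) (u : Fin n) → u ∉ S F →
  (S (F ∪ ⁅ u ⁆) ≡ S F) × (S (F ─ ⁅ u ⁆) ≡ S F)

module _ {n : ℕ} (S : Subset n → Subset n) where
  α : Subset n → Subset n
  α F = F ∩ S F

  τ : Subset n → Subset n
  τ F = F ∪ ∁ (S F)

-- Call G S-equivalent to F when G agrees with F on Shade F; the interval
-- [α F, τ F] is exactly the class of such G.  Walking from F to such a G one
-- coordinate at a time only flips coordinates outside the current shade (the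
-- others are already right), and a shade map is unchanged by such flips, so
-- Shade G = Shade F.  Hence S-equivalence is an equivalence relation whose
-- classes are the intervals, which gives (a)-(c); (d) is a Boolean identity.
module Submission where

open import Defs
open import Data.Nat using (ℕ)
open import Data.Fin using (Fin; _≟_)
open import Data.Fin.Subset using (Subset; _∈_; _∉_; _⊆_; _∪_; _∩_; _─_; ∁; ⁅_⁆; inside; outside)
open import Data.Fin.Subset.Properties
open import Data.List using (List; []; _∷_; foldr; allFin)
import Data.List.Membership.Propositional as List
open import Data.List.Membership.Propositional.Properties using (∈-allFin)
import Data.List.Relation.Unary.Any as Any
open import Data.Product using (_×_; _,_; proj₁; proj₂)
open import Data.Sum using (_⊎_; inj₁; inj₂)
open import Data.Vec using ([]; _∷_; here; there)
open import Function.Bundles using (_⇔_; mk⇔; Equivalence)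
import Function.Properties.Equivalence as ⇔
open import Relation.Binary.PropositionalEquality using (_≡_; refl; sym; trans; cong; subst; module ≡-Reasoning)
open import Relation.Nullary using (¬_; yes; no; contradiction)
open import Relation.Unary using (_≐_)
open import Relation.Unary.Properties using (≐-refl; ≐-sym; ≐-trans)

open Equivalence using (to; from)

private
  variable
    n : ℕ

x∈p─q⇒x∉q : ∀ {x : Fin n} {p q : Subset n} → x ∈ p ─ q → x ∉ q
x∈p─q⇒x∉q {p = inside ∷ _} {outside ∷ _} here ()
x∈p─q⇒x∉q {p = _ ∷ _}      {_ ∷ _}       (there x∈p─q) (there x∈q) = x∈p─q⇒x∉q x∈p─q x∈q

⊆-antisym-⇔ : {p q : Subset n} → (∀ {x} → x ∈ p ⇔ x ∈ q) → p ≡ q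
⊆-antisym-⇔ p≈q = ⊆-antisym (to p≈q) (from p≈q)

p≡∁[q∪∁p─q∩p] : (p q : Subset n) → p ≡ ∁ ((q ∪ ∁ p) ─ (q ∩ p))
p≡∁[q∪∁p─q∩p] []            []            = refl
p≡∁[q∪∁p─q∩p] (inside  ∷ p) (inside  ∷ q) = cong (inside  ∷_) (p≡∁[q∪∁p─q∩p] p q)
p≡∁[q∪∁p─q∩p] (inside  ∷ p) (outside ∷ q) = cong (inside  ∷_) (p≡∁[q∪∁p─q∩p] p q)
p≡∁[q∪∁p─q∩p] (outside ∷ p) (inside  ∷ q) = cong (outside ∷_) (p≡∁[q∪∁p─q∩p] p q)
p≡∁[q∪∁p─q∩p] (outside ∷ p) (outside ∷ q) = cong (outside ∷_) (p≡∁[q∪∁p─q∩p] p q)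

infix 4 _≈[_]_

_≈[_]_ : Subset n → Subset n → Subset n → Set
F ≈[ A ] G = ∀ {x} → x ∈ A → x ∈ F ⇔ x ∈ G

≈-refl : {F A : Subset n} → F ≈[ A ] F
≈-refl _ = ⇔.refl

≈-sym : {F G A : Subset n} → F ≈[ A ] G → G ≈[ A ] F
≈-sym F≈G x∈A = ⇔.sym (F≈G x∈A)

≈-trans : {F G H A : Subset n} → F ≈[ A ] G → G ≈[ A ] H → F ≈[ A ] H
≈-trans F≈G G≈H x∈A = ⇔.trans (F≈G x∈A) (G≈H x∈A)

copyAt : Subset n → Fin n → Subset n → Subset n
copyAt G i H with i ∈? G
... | yes _ = H ∪ ⁅ i ⁆
... | no  _ = H ─ ⁅ i ⁆

∈-copyAt-≢ : (G : Subset n) {i j : Fin n} (H : Subset n) → ¬ j ≡ i →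
             j ∈ copyAt G i H ⇔ j ∈ H
∈-copyAt-≢ G {i} {j} H j≢i with i ∈? G
... | yes _ = mk⇔ (λ j∈H∪i → from-∪ (x∈p∪q⁻ H ⁅ i ⁆ j∈H∪i)) (λ j∈H → x∈p∪q⁺ (inj₁ j∈H))
  where
  from-∪ : j ∈ H ⊎ j ∈ ⁅ i ⁆ → j ∈ H
  from-∪ (inj₁ j∈H) = j∈H
  from-∪ (inj₂ j∈i) = contradiction (x∈⁅y⁆⇒x≡y i j∈i) j≢i
... | no _ = mk⇔ (p─q⊆p H ⁅ i ⁆) (λ j∈H → x∈p∧x≢y⇒x∈p-y j∈H j≢i)

∈-copyAt-≡ : (G : Subset n) (i : Fin n) (H : Subset n) → i ∈ copyAt G i H ⇔ i ∈ G
∈-copyAt-≡ G i H with i ∈? G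
... | yes i∈G = mk⇔ (λ _ → i∈G) (λ _ → x∈p∪q⁺ (inj₂ (x∈⁅x⁆ i)))
... | no  i∉G = mk⇔ (λ i∈H─i → contradiction (x∈⁅x⁆ i) (x∈p─q⇒x∉q i∈H─i))
                    (λ i∈G → contradiction i∈G i∉G)

copyAt-idem : (G : Subset n) (i : Fin n) (H : Subset n) → (i ∈ H ⇔ i ∈ G) → copyAt G i H ≡ H
copyAt-idem G i H i∈H⇔i∈G = ⊆-antisym-⇔ agree
  where
  agree : ∀ {j} → j ∈ copyAt G i H ⇔ j ∈ H
  agree {j} with j ≟ i
  ... | yes refl = ⇔.trans (∈-copyAt-≡ G j H) (⇔.sym i∈H⇔i∈G)
  ... | no  j≢i  = ∈-copyAt-≢ G H j≢i

copyAll : List (Fin n) → Subset n → Subset n → Subset n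
copyAll is G H = foldr (copyAt G) H is

∈-copyAll-∈ : (G H : Subset n) {is : List (Fin n)} {j : Fin n} → j List.∈ is →
              j ∈ copyAll is G H ⇔ j ∈ G
∈-copyAll-∈ G H {i ∷ is} {j} j∈i∷is with j ≟ i | j∈i∷is
... | yes refl | _              = ∈-copyAt-≡ G j (copyAll is G H)
... | no  j≢i  | Any.here j≡i   = contradiction j≡i j≢i
... | no  j≢i  | Any.there j∈is = ⇔.trans (∈-copyAt-≢ G (copyAll is G H) j≢i) (∈-copyAll-∈ G H j∈is)

copyAll-allFin : (G H : Subset n) → copyAll (allFin n) G H ≡ G
copyAll-allFin G H = ⊆-antisym-⇔ λ {j} → ∈-copyAll-∈ G H (∈-allFin j)

copyAll-≈ : {G H A : Subset n} (is : List (Fin n)) → H ≈[ A ] G → copyAll is G H ≈[ A ] H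
copyAll-≈ []                     H≈G x∈A = ⇔.refl
copyAll-≈ {G = G} {H} (i ∷ is)   H≈G {j} j∈A with j ≟ i
... | yes refl = ⇔.trans (∈-copyAt-≡ G j (copyAll is G H)) (⇔.sym (H≈G j∈A))
... | no  j≢i  = ⇔.trans (∈-copyAt-≢ G (copyAll is G H) j≢i) (copyAll-≈ is H≈G j∈A)

module _ (S : Subset n → Subset n) where

  interval⇒≈ : {F G : Subset n} → [ α S F , τ S F ] G → F ≈[ S F ] G
  interval⇒≈ {F} (α⊆G , G⊆τ) {x} x∈SF =
    mk⇔ (λ x∈F → α⊆G (x∈p∩q⁺ (x∈F , x∈SF))) (λ x∈G → from-τ (x∈p∪q⁻ F (∁ (S F)) (G⊆τ x∈G)))
    where
    from-τ : x ∈ F ⊎ x ∈ ∁ (S F) → x ∈ F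
    from-τ (inj₁ x∈F)   = x∈F
    from-τ (inj₂ x∈∁SF) = contradiction x∈SF (x∈∁p⇒x∉p x∈∁SF)

  ≈⇒interval : {F G : Subset n} → F ≈[ S F ] G → [ α S F , τ S F ] G
  ≈⇒interval {F} {G} F≈G = α⊆G , G⊆τ
    where
    α⊆G : α S F ⊆ G
    α⊆G x∈α = let x∈F , x∈SF = x∈p∩q⁻ F (S F) x∈α in to (F≈G x∈SF) x∈F
    G⊆τ : G ⊆ τ S F
    G⊆τ {x} x∈G with x ∈? S F
    ... | yes x∈SF = x∈p∪q⁺ (inj₁ (from (F≈G x∈SF) x∈G))
    ... | no  x∉SF = x∈p∪q⁺ (inj₂ (x∉p⇒x∈∁p x∉SF))

module _ {S : Subset n → Subset n} (shade : IsShadeMap S) where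

  copyAt-shade : (G : Subset n) {i : Fin n} (H : Subset n) → i ∉ S H → S (copyAt G i H) ≡ S H
  copyAt-shade G {i} H i∉SH with i ∈? G
  ... | yes _ = proj₁ (shade H i i∉SH)
  ... | no  _ = proj₂ (shade H i i∉SH)

  copyAll-shade : {G H : Subset n} (is : List (Fin n)) → H ≈[ S H ] G → S (copyAll is G H) ≡ S H
  copyAll-shade [] _ = refl
  copyAll-shade {G} {H} (i ∷ is) H≈G with i ∈? S (copyAll is G H)
  ... | no  i∉SK = trans (copyAt-shade G (copyAll is G H) i∉SK) (copyAll-shade is H≈G)
  ... | yes i∈SK = trans (cong S (copyAt-idem G i (copyAll is G H) agree-at-i)) (copyAll-shade is H≈G)
    where
    i∈SH : i ∈ S H
    i∈SH = subst (i ∈_) (copyAll-shade is H≈G) i∈SK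
    agree-at-i : i ∈ copyAll is G H ⇔ i ∈ G
    agree-at-i = ⇔.trans (copyAll-≈ is H≈G i∈SH) (H≈G i∈SH)

  ≈⇒shade-≡ : {F G : Subset n} → F ≈[ S F ] G → S G ≡ S F
  ≈⇒shade-≡ {F} {G} F≈G = begin
    S G                          ≡⟨ cong S (copyAll-allFin G F) ⟨
    S (copyAll (allFin n) G F)   ≡⟨ copyAll-shade (allFin n) F≈G ⟩
    S F                          ∎
    where open ≡-Reasoning

  interval-≐ : {F G : Subset n} → [ α S F , τ S F ] G → [ α S F , τ S F ] ≐ [ α S G , τ S G ]
  interval-≐ {F} {G} G∈F = (λ H∈F → ≈⇒interval S (G≈[SG] (≈-trans (≈-sym F≈G) (interval⇒≈ S H∈F))))
                         , (λ H∈G → ≈⇒interval S (≈-trans F≈G (G≈[SF] (interval⇒≈ S H∈G))))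
    where
    F≈G : F ≈[ S F ] G
    F≈G = interval⇒≈ S G∈F
    G≈[SG] : ∀ {H} → G ≈[ S F ] H → G ≈[ S G ] H
    G≈[SG] {H} = subst (λ A → G ≈[ A ] H) (sym (≈⇒shade-≡ F≈G))
    G≈[SF] : ∀ {H} → G ≈[ S G ] H → G ≈[ S F ] H
    G≈[SF] {H} = subst (λ A → G ≈[ A ] H) (≈⇒shade-≡ F≈G)

theorem4p30 : (n : ℕ) (S : Subset n → Subset n) → IsShadeMap S →
    (∀ (F : Subset n) → [ α S F , τ S F ] F) ×
    (∀ (F G : Subset n) → [ α S F , τ S F ] G → [ α S F , τ S F ] ≐ [ α S G , τ S G ]) ×
    IsBooleanIntervalPartition (λ (F : Subset n) → [ α S F , τ S F ]) ×
    (∀ (F : Subset n) → S F ≡ ∁ (τ S F ─ α S F))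
theorem4p30 n S shade =
  F∈intervalF , (λ F G → interval-≐ shade) ,
  ((λ F → α S F , τ S F , ≐-refl) , disjoint , (λ F → F , F∈intervalF F)) ,
  (λ F → p≡∁[q∪∁p─q∩p] (S F) F)
  where
  F∈intervalF : ∀ F → [ α S F , τ S F ] F
  F∈intervalF F = ≈⇒interval S ≈-refl
  disjoint : ∀ F G → ¬ ([ α S F , τ S F ] ≐ [ α S G , τ S G ]) →
             ∀ I → ¬ ([ α S F , τ S F ] I × [ α S G , τ S G ] I)
  disjoint F G F≉G I (I∈F , I∈G) = F≉G (≐-trans (interval-≐ shade I∈F) (≐-sym (interval-≐ shade I∈G)))
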